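{- Let $0<\varepsilon\le 1/2$, let $h:\{0,1\}^n\to\{0,1\}$ with $h^{ -1}(1)\ne\emptyset$, let $\emptyset\ne R\subseteq[n]$ with $\overline R=[n]\setminus R$, and let $\mathfrak J:\{0,1\}^R\to\{0,1\}$ with $\mathfrak J^{ -1}(1)\neq\emptyset$. Define $\Gamma:\{0,1\}^{\overline R}\to\{0,1\}$ by $\Gamma(\alpha)=1$ iff $\Pr_{z\sim\mathfrak J^{ -1}(1)}[h(\alpha\circ z)=1]\ge0.9$, and $\gamma:\{0,1\}^n\to\{0,1\}$ by $\gamma(z)=1$ iff $\Gamma(z_{\overline R})=1$ and $\mathfrak J(z_R)=1$. Assume $|h^{ -1}(1)\setminus\gamma^{ -1}(1)|\le\varepsilon|h^{ -1}(1)|/20$. Then for every $\alpha\in\{0,1\}^{\overline R}$ with $\Gamma(\alpha)=1$, $$\Pr_{z\sim h^{ -1}(1)}[z_{\overline R}=\alpha]\ge\frac{1}{2|\Gamma^{ -1}(1)|}.$$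
   Context: All samples are uniform over the indicated sets. For $z\in\{0,1\}^n$ and $A\subseteq[n]$, $z_A$ is the restriction of $z$ to the coordinates in $A$; $\alpha\circ z$ denotes the string in $\{0,1\}^n$ agreeing with $\alpha$ on $\overline R$ and with $z$ on $R$.
   Formalization: The parameter ε ranges over the rationals with $0<\varepsilon\le 1/2$. -}

module Defs where

open import Data.Bool using (Bool; true; false; _∧_; not; if_then_else_)
open import Data.Nat using (ℕ; zero; suc; _+_; _*_; _≤ᵇ_)
open import Data.List using (List; []; _∷_; _++_; map)
open import Data.Vec using (Vec; []; _∷_)
open import Data.Fin.Subset using (Subset; ∁)

Str : ℕ → Set
Str k = Vec Bool k

size : ∀ {n} → Subset n → ℕ
size []          = 0
size (true ∷ A)  = suc (size A)
size (false ∷ A) = size A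

cube : (k : ℕ) → List (Str k)
cube zero    = [] ∷ []
cube (suc k) = map (false ∷_) (cube k) ++ map (true ∷_) (cube k)

countL : ∀ {A : Set} → (A → Bool) → List A → ℕ
countL p []       = 0
countL p (x ∷ xs) = if p x then suc (countL p xs) else countL p xs

ones : ∀ {k} → (Str k → Bool) → ℕ
ones {k} f = countL f (cube k)

restrict : ∀ {n} (A : Subset n) → Str n → Str (size A)
restrict []          []      = []
restrict (true ∷ A)  (b ∷ z) = b ∷ restrict A z
restrict (false ∷ A) (b ∷ z) = restrict A z

merge : ∀ {n} (R : Subset n) → Str (size (∁ R)) → Str (size R) → Str n
merge []          []      []      = []
merge (true ∷ R)  α       (b ∷ z) = b ∷ merge R α z
merge (false ∷ R) (a ∷ α) z       = a ∷ merge R α z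

eqStr : ∀ {k} → Str k → Str k → Bool
eqStr []      []      = true
eqStr (a ∷ x) (b ∷ y) = (if a then b else not b) ∧ eqStr x y

-- Γ(α) = 1 iff Pr_{z ~ J⁻¹(1)}[h(α∘z)=1] ≥ 0.9,
-- i.e. 10 · #{z : J z = 1, h(α∘z)=1} ≥ 9 · |J⁻¹(1)|
Γ : ∀ {n} (h : Str n → Bool) (R : Subset n) (J : Str (size R) → Bool)
    → Str (size (∁ R)) → Bool
Γ h R J α = (9 * ones J) ≤ᵇ (10 * countL (λ z → J z ∧ h (merge R α z)) (cube (size R)))

γ : ∀ {n} (h : Str n → Bool) (R : Subset n) (J : Str (size R) → Bool)
    → Str n → Bool
γ h R J z = Γ h R J (restrict (∁ R) z) ∧ J (restrict R z)

-- At most an ε/20 ≤ 1/40 fraction of h⁻¹(1) lies outside γ⁻¹(1) = Γ⁻¹(1) × J⁻¹(1),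
-- so 39|h⁻¹(1)| ≤ 40|Γ⁻¹(1)||J⁻¹(1)|. If Γ(α) = 1, the fibre of h⁻¹(1) over α contains
-- the at least 0.9|J⁻¹(1)| strings α ∘ z with J(z) = 1 = h(α ∘ z); hence
-- |h⁻¹(1)| ≤ (400/351)|Γ⁻¹(1)||fibre| ≤ 2|Γ⁻¹(1)||fibre|.
module Submission where

open import Defs
open import Data.Bool using (Bool; true; false; not; _∧_; T)
open import Data.Bool.Properties using (∧-zeroʳ)
open import Data.Nat using (ℕ; suc; _+_; _*_; _≤_; z≤n; s≤s)
open import Data.Nat.Properties
open import Data.Nat.Tactic.RingSolver using (solve)
open import Data.Integer using (+_) renaming (_≤_ to _≤ℤ_)
import Data.Integer.Properties as ℤ
open import Data.Rational using (ℚ; 0ℚ; ½; _/_; toℚᵘ)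
  renaming (_*_ to _*ℚ_; _≤_ to _≤ℚ_; _<_ to _<ℚ_)
import Data.Rational.Properties as ℚ
open import Data.Rational.Unnormalised using (mkℚᵘ; *≤*) renaming (_≤_ to _≤ᵘ_; _*_ to _*ᵘ_)
import Data.Rational.Unnormalised.Properties as ℚᵘ
open import Data.Fin.Subset using (Subset; ∁; Nonempty)
open import Data.Product using (∃)
open import Data.List using ([]; _∷_; _++_; map)
import Data.List as List
open import Data.Vec using ([]; _∷_)
open import Data.Unit using (tt)
open import Relation.Binary.PropositionalEquality

countL-++ : ∀ {A : Set} (p : A → Bool) xs ys →
            countL p (xs ++ ys) ≡ countL p xs + countL p ys
countL-++ p []       ys = refl
countL-++ p (x ∷ xs) ys with p x
... | true  = cong suc (countL-++ p xs ys)
... | false = countL-++ p xs ys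

countL-map : ∀ {A B : Set} (p : B → Bool) (f : A → B) xs →
             countL p (map f xs) ≡ countL (λ x → p (f x)) xs
countL-map p f []       = refl
countL-map p f (x ∷ xs) with p (f x)
... | true  = cong suc (countL-map p f xs)
... | false = countL-map p f xs

countL-≡false : ∀ {A : Set} (p : A → Bool) → (∀ x → p x ≡ false) → ∀ xs → countL p xs ≡ 0
countL-≡false p p≡false []       = refl
countL-≡false p p≡false (x ∷ xs) rewrite p≡false x = countL-≡false p p≡false xs

countL-∧-≤ʳ : ∀ {A : Set} (p q : A → Bool) xs → countL (λ x → p x ∧ q x) xs ≤ countL q xs
countL-∧-≤ʳ p q []       = z≤n
countL-∧-≤ʳ p q (x ∷ xs) with p x | q x
... | true  | true  = s≤s (countL-∧-≤ʳ p q xs)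
... | true  | false = countL-∧-≤ʳ p q xs
... | false | true  = m≤n⇒m≤1+n (countL-∧-≤ʳ p q xs)
... | false | false = countL-∧-≤ʳ p q xs

countL-partition : ∀ {A : Set} (p q : A → Bool) xs →
                   countL p xs ≡ countL (λ x → p x ∧ q x) xs + countL (λ x → p x ∧ not (q x)) xs
countL-partition p q []       = refl
countL-partition p q (x ∷ xs) with p x | q x
... | true  | true  = cong suc (countL-partition p q xs)
... | true  | false = trans (cong suc (countL-partition p q xs)) (sym (+-suc _ _))
... | false | _     = countL-partition p q xs

ones-suc : ∀ {k} (p : Str (suc k) → Bool) →
           ones p ≡ ones (λ z → p (false ∷ z)) + ones (λ z → p (true ∷ z))
ones-suc {k} p = begin
  countL p (map (false ∷_) (cube k) ++ map (true ∷_) (cube k))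
    ≡⟨ countL-++ p (map (false ∷_) (cube k)) (map (true ∷_) (cube k)) ⟩
  countL p (map (false ∷_) (cube k)) + countL p (map (true ∷_) (cube k))
    ≡⟨ cong₂ _+_ (countL-map p (false ∷_) (cube k)) (countL-map p (true ∷_) (cube k)) ⟩
  ones (λ z → p (false ∷ z)) + ones (λ z → p (true ∷ z)) ∎
  where open ≡-Reasoning

ones-product : ∀ {n} (R : Subset n) (P : Str (size (∁ R)) → Bool) (Q : Str (size R) → Bool) →
               ones (λ z → P (restrict (∁ R) z) ∧ Q (restrict R z)) ≡ ones P * ones Q
ones-product [] P Q with P [] | Q []
... | true  | true  = refl
... | true  | false = refl
... | false | _     = refl
ones-product (true ∷ R) P Q = begin
  ones (λ z → P (restrict (∁ (true ∷ R)) z) ∧ Q (restrict (true ∷ R) z))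
    ≡⟨ ones-suc (λ z → P (restrict (∁ (true ∷ R)) z) ∧ Q (restrict (true ∷ R) z)) ⟩
  _ ≡⟨ cong₂ _+_ (ones-product R P Q₀) (ones-product R P Q₁) ⟩
  ones P * ones Q₀ + ones P * ones Q₁
    ≡⟨ *-distribˡ-+ (ones P) (ones Q₀) (ones Q₁) ⟨
  ones P * (ones Q₀ + ones Q₁)
    ≡⟨ cong (ones P *_) (ones-suc Q) ⟨
  ones P * ones Q ∎
  where
  open ≡-Reasoning
  Q₀ Q₁ : Str (size R) → Bool
  Q₀ w = Q (false ∷ w)
  Q₁ w = Q (true ∷ w)
ones-product (false ∷ R) P Q = begin
  ones (λ z → P (restrict (∁ (false ∷ R)) z) ∧ Q (restrict (false ∷ R) z))
    ≡⟨ ones-suc (λ z → P (restrict (∁ (false ∷ R)) z) ∧ Q (restrict (false ∷ R) z)) ⟩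
  _ ≡⟨ cong₂ _+_ (ones-product R P₀ Q) (ones-product R P₁ Q) ⟩
  ones P₀ * ones Q + ones P₁ * ones Q
    ≡⟨ *-distribʳ-+ (ones Q) (ones P₀) (ones P₁) ⟨
  (ones P₀ + ones P₁) * ones Q
    ≡⟨ cong (_* ones Q) (ones-suc P) ⟨
  ones P * ones Q ∎
  where
  open ≡-Reasoning
  P₀ P₁ : Str (size (∁ R)) → Bool
  P₀ w = P (false ∷ w)
  P₁ w = P (true ∷ w)

ones-fibre : ∀ {n} (R : Subset n) (α : Str (size (∁ R))) (f : Str n → Bool) →
             ones (λ z → f z ∧ eqStr (restrict (∁ R) z) α) ≡ ones (λ w → f (merge R α w))
ones-fibre [] [] f with f []
... | true  = refl
... | false = refl
ones-fibre (true ∷ R) α f = begin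
  ones (λ z → f z ∧ eqStr (restrict (∁ (true ∷ R)) z) α)
    ≡⟨ ones-suc (λ z → f z ∧ eqStr (restrict (∁ (true ∷ R)) z) α) ⟩
  _ ≡⟨ cong₂ _+_ (ones-fibre R α (λ z → f (false ∷ z))) (ones-fibre R α (λ z → f (true ∷ z))) ⟩
  _ ≡⟨ ones-suc (λ w → f (merge (true ∷ R) α w)) ⟨
  ones (λ w → f (merge (true ∷ R) α w)) ∎
  where open ≡-Reasoning
ones-fibre (false ∷ R) (false ∷ α) f = begin
  ones (λ z → f z ∧ eqStr (restrict (∁ (false ∷ R)) z) (false ∷ α))
    ≡⟨ ones-suc (λ z → f z ∧ eqStr (restrict (∁ (false ∷ R)) z) (false ∷ α)) ⟩
  _ ≡⟨ cong₂ _+_ (ones-fibre R α (λ z → f (false ∷ z)))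
                 (countL-≡false _ (λ z → ∧-zeroʳ (f (true ∷ z))) (cube _)) ⟩
  _ ≡⟨ +-identityʳ _ ⟩
  ones (λ w → f (merge (false ∷ R) (false ∷ α) w)) ∎
  where open ≡-Reasoning
ones-fibre (false ∷ R) (true ∷ α) f = begin
  ones (λ z → f z ∧ eqStr (restrict (∁ (false ∷ R)) z) (true ∷ α))
    ≡⟨ ones-suc (λ z → f z ∧ eqStr (restrict (∁ (false ∷ R)) z) (true ∷ α)) ⟩
  _ ≡⟨ cong₂ _+_ (countL-≡false _ (λ z → ∧-zeroʳ (f (false ∷ z))) (cube _))
                 (ones-fibre R α (λ z → f (true ∷ z))) ⟩
  ones (λ w → f (merge (false ∷ R) (true ∷ α) w)) ∎
  where open ≡-Reasoning

ones-≤-product+outside : ∀ {n} (R : Subset n) (P : Str (size (∁ R)) → Bool)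
                           (Q : Str (size R) → Bool) (f : Str n → Bool) →
                         ones f ≤ ones P * ones Q
                                  + ones (λ z → f z ∧ not (P (restrict (∁ R) z) ∧ Q (restrict R z)))
ones-≤-product+outside {n} R P Q f = begin
  ones f                            ≡⟨ countL-partition f g (cube n) ⟩
  ones (λ z → f z ∧ g z) + outside  ≤⟨ +-monoˡ-≤ outside (countL-∧-≤ʳ f g (cube n)) ⟩
  ones g + outside                  ≡⟨ cong (_+ outside) (ones-product R P Q) ⟩
  ones P * ones Q + outside         ∎
  where
  open ≤-Reasoning
  g : Str n → Bool
  g z = P (restrict (∁ R) z) ∧ Q (restrict R z)
  outside : ℕ
  outside = ones (λ z → f z ∧ not (g z))

≤½*⇒2*≤ : ∀ a b → (+ a) / 1 ≤ℚ ½ *ℚ ((+ b) / 1) → 2 * a ≤ b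
≤½*⇒2*≤ a b a≤½b = cross-multiply unnormalised
  where
  unnormalised : mkℚᵘ (+ a) 0 ≤ᵘ mkℚᵘ (+ 1) 1 *ᵘ mkℚᵘ (+ b) 0
  unnormalised = begin
    mkℚᵘ (+ a) 0                 ≃⟨ ℚ.toℚᵘ-fromℚᵘ (mkℚᵘ (+ a) 0) ⟨
    toℚᵘ ((+ a) / 1)             ≤⟨ ℚ.toℚᵘ-mono-≤ a≤½b ⟩
    toℚᵘ (½ *ℚ ((+ b) / 1))      ≃⟨ ℚ.toℚᵘ-homo-* ½ ((+ b) / 1) ⟩
    toℚᵘ ½ *ᵘ toℚᵘ ((+ b) / 1)   ≃⟨ ℚᵘ.*-congˡ {toℚᵘ ½} (ℚ.toℚᵘ-fromℚᵘ (mkℚᵘ (+ b) 0)) ⟩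
    mkℚᵘ (+ 1) 1 *ᵘ mkℚᵘ (+ b) 0 ∎
    where open ℚᵘ.≤-Reasoning
  cross-multiply : mkℚᵘ (+ a) 0 ≤ᵘ mkℚᵘ (+ 1) 1 *ᵘ mkℚᵘ (+ b) 0 → 2 * a ≤ b
  cross-multiply (*≤* a*2≤1*b*1) = subst (_≤ b) (*-comm a 2) (ℤ.drop‿+≤+ a*2≤b)
    where
    a*2≤b : + (a * 2) ≤ℤ + b
    a*2≤b = subst₂ _≤ℤ_ (sym (ℤ.pos-* a 2)) (trans (ℤ.*-identityʳ _) (ℤ.*-identityˡ _)) a*2≤1*b*1

counting-bounds⇒≤2* : ∀ H B G j F → H ≤ G * j + B → 40 * B ≤ H → 9 * j ≤ 10 * F →
                        H ≤ 2 * G * F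
counting-bounds⇒≤2* H B G j F H≤Gj+B 40B≤H 9j≤10F = *-cancelˡ-≤ 351 (begin
  351 * H            ≡⟨ solve (H List.∷ List.[]) ⟩
  9 * (39 * H)       ≤⟨ *-monoʳ-≤ 9 39H≤40Gj ⟩
  9 * (40 * (G * j)) ≡⟨ solve (G List.∷ j List.∷ List.[]) ⟩
  40 * G * (9 * j)   ≤⟨ *-monoʳ-≤ (40 * G) 9j≤10F ⟩
  40 * G * (10 * F)  ≡⟨ solve (G List.∷ F List.∷ List.[]) ⟩
  400 * (G * F)      ≤⟨ *-monoˡ-≤ (G * F) (m≤m+n 400 302) ⟩
  702 * (G * F)      ≡⟨ solve (G List.∷ F List.∷ List.[]) ⟩
  351 * (2 * G * F)  ∎)
  where
  open ≤-Reasoning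
  39H≤40Gj : 39 * H ≤ 40 * (G * j)
  39H≤40Gj = +-cancelʳ-≤ H (39 * H) (40 * (G * j)) (begin
    39 * H + H            ≡⟨ solve (H List.∷ List.[]) ⟩
    40 * H                ≤⟨ *-monoʳ-≤ 40 H≤Gj+B ⟩
    40 * (G * j + B)      ≡⟨ *-distribˡ-+ 40 (G * j) B ⟩
    40 * (G * j) + 40 * B ≤⟨ +-monoʳ-≤ (40 * (G * j)) 40B≤H ⟩
    40 * (G * j) + H      ∎)

lemma80 : (ε : ℚ) → 0ℚ <ℚ ε → ε ≤ℚ ½
    → (n : ℕ) (h : Str n → Bool) → ∃ (λ z → h z ≡ true)
    → (R : Subset n) → Nonempty R
    → (J : Str (size R) → Bool) → ∃ (λ z → J z ≡ true)
    → ((+ (20 * ones (λ z → h z ∧ not (γ h R J z)))) / 1) ≤ℚ (ε *ℚ ((+ (ones h)) / 1))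
    → (α : Str (size (∁ R))) → Γ h R J α ≡ true
    → ones h ≤ 2 * ones (Γ h R J) * ones (λ z → h z ∧ eqStr (restrict (∁ R) z) α)
lemma80 _ _ ε≤½ _ h _ R _ J _ few-outside α Γα≡true =
  counting-bounds⇒≤2* (ones h) outside (ones (Γ h R J)) (ones J) fibre
    (ones-≤-product+outside R (Γ h R J) J h) 40*outside≤ones-h 9*ones-J≤10*fibre
  where
  outside fibre : ℕ
  outside = ones (λ z → h z ∧ not (γ h R J z))
  fibre   = ones (λ z → h z ∧ eqStr (restrict (∁ R) z) α)

  40*outside≤ones-h : 40 * outside ≤ ones h
  40*outside≤ones-h = subst (_≤ ones h) (sym (*-assoc 2 20 outside))
    (≤½*⇒2*≤ (20 * outside) (ones h)
      (ℚ.≤-trans few-outside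
        (ℚ.*-monoʳ-≤-nonNeg ((+ ones h) / 1) {{ℚ.normalize-nonNeg (ones h) 1}} ε≤½)))

  good-completions : ℕ
  good-completions = ones (λ z → J z ∧ h (merge R α z))

  9*ones-J≤10*fibre : 9 * ones J ≤ 10 * fibre
  9*ones-J≤10*fibre = begin
    9 * ones J                        ≤⟨ ≤ᵇ⇒≤ _ _ (subst T (sym Γα≡true) tt) ⟩
    10 * good-completions             ≤⟨ *-monoʳ-≤ 10 (countL-∧-≤ʳ J (λ w → h (merge R α w)) (cube (size R))) ⟩
    10 * ones (λ w → h (merge R α w)) ≡⟨ cong (10 *_) (ones-fibre R α h) ⟨
    10 * fibre                        ∎
    where open ≤-Reasoning
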